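{- Let $M\subseteq\{\pm e_1,\dots,\pm e_n\}\subset\mathbb R^n$ be a Coxeter matroid for the root system $D_n$, i.e. every edge of $\mathrm{conv}(M)$ is parallel to a root $\pm e_i\pm e_j$ ($i\neq j$). Then $M$ is a strong Coxeter matroid.
   Context: $\{\pm e_1,\dots,\pm e_n\}$ is the $W(D_n)$-orbit of $-e_1$ (the cosets for the maximal parabolic omitting the first simple reflection). $M$ is a strong Coxeter matroid if for any distinct $p,q\in M$ there is a root $\alpha\in\{\pm e_i\pm e_j: i\ne j\}$ whose hyperplane $\alpha^\perp$ separates $p$ and $q$ with $s_\alpha p,s_\alpha q\in M$, where $s_\alpha$ is the reflection in $\alpha^\perp$. -}

module Defs where

open import Data.Nat using (ℕ; zero; suc)
open import Data.Fin using (Fin; zero; suc; _≟_)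
open import Relation.Nullary using (yes; no)
open import Data.Integer using (ℤ; +_; -_; _+_; _-_; _*_; _<_; 0ℤ; 1ℤ)
open import Data.Bool using (Bool; true; false)
open import Data.Product using (_×_; ∃; ∃-syntax; Σ-syntax; _,_)
open import Data.Sum using (_⊎_)
open import Relation.Binary.PropositionalEquality using (_≡_; _≢_)

Vecℤ : ℕ → Set
Vecℤ n = Fin n → ℤ

sumℤ : ∀ {n} → Vecℤ n → ℤ
sumℤ {zero}  v = 0ℤ
sumℤ {suc n} v = v zero + sumℤ (λ k → v (suc k))

_·_ : ∀ {n} → Vecℤ n → Vecℤ n → ℤ
u · v = sumℤ (λ k → u k * v k)

_⊖_ : ∀ {n} → Vecℤ n → Vecℤ n → Vecℤ n
(u ⊖ v) k = u k - v k

_⊛_ : ∀ {n} → ℤ → Vecℤ n → Vecℤ n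
(a ⊛ v) k = a * v k

e : ∀ {n} → Fin n → Vecℤ n
e i k with i ≟ k
... | yes _ = 1ℤ
... | no  _ = 0ℤ

data Sign : Set where
  plus minus : Sign

sgn : Sign → ℤ
sgn plus  = 1ℤ
sgn minus = - 1ℤ

-- Points of the orbit {±e_1,…,±e_n}: (s , i) stands for s·e_i.
Pt : ℕ → Set
Pt n = Sign × Fin n

vec : ∀ {n} → Pt n → Vecℤ n
vec (s , i) = sgn s ⊛ e i

Sub : ℕ → Set
Sub n = Pt n → Bool

_∈_ : ∀ {n} → Pt n → Sub n → Set
p ∈ M = M p ≡ true

IsRoot : ∀ {n} → Vecℤ n → Set
IsRoot {n} α = Σ[ s ∈ Sign ] Σ[ i ∈ Fin n ] Σ[ t ∈ Sign ] Σ[ j ∈ Fin n ]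
  (i ≢ j) × (∀ k → α k ≡ (sgn s ⊛ e i) k + (sgn t ⊛ e j) k)

-- v is parallel to α: a·v = b·α for some integers a ≠ 0 (v ≠ 0 forces b ≠ 0).
Parallel : ∀ {n} → Vecℤ n → Vecℤ n → Set
Parallel v α = ∃[ a ] ∃[ b ] (a ≢ 0ℤ) × (∀ k → (a ⊛ v) k ≡ (b ⊛ α) k)

-- [p,q] is an edge of conv(M): p, q are distinct points of M and some
-- linear functional c attains its maximum over M exactly at {p,q}.
IsEdge : ∀ {n} → Sub n → Pt n → Pt n → Set
IsEdge {n} M p q =
  p ∈ M × q ∈ M × p ≢ q ×
  ∃[ c ] ((c · vec p ≡ c · vec q) ×
          (∀ r → r ∈ M → r ≢ p → r ≢ q → c · vec r < c · vec p))

IsCoxeterMatroid : ∀ {n} → Sub n → Set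
IsCoxeterMatroid M = ∀ p q → IsEdge M p q →
  ∃[ α ] (IsRoot α × Parallel (vec p ⊖ vec q) α)

-- Reflection in α^⊥ : s_α(x) = x - (2 (α·x)/(α·α)) α ; for roots α·α = 2.
refl-in : ∀ {n} → Vecℤ n → Vecℤ n → Vecℤ n
refl-in α x = x ⊖ ((α · x) ⊛ α)

_∈ᵥ_ : ∀ {n} → Vecℤ n → Sub n → Set
x ∈ᵥ M = ∃[ r ] (r ∈ M × (∀ k → vec r k ≡ x k))

Separates : ∀ {n} → Vecℤ n → Vecℤ n → Vecℤ n → Set
Separates α x y = ((0ℤ < α · x) × (α · y < 0ℤ)) ⊎ ((α · x < 0ℤ) × (0ℤ < α · y))

IsStrongCoxeterMatroid : ∀ {n} → Sub n → Set
IsStrongCoxeterMatroid M = ∀ p q → p ∈ M → q ∈ M → p ≢ q →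
  ∃[ α ] (IsRoot α × Separates α (vec p) (vec q) ×
          refl-in α (vec p) ∈ᵥ M × refl-in α (vec q) ∈ᵥ M)

-- If p and q lie on different axes, the root α = p − q swaps them. If q = −p, any
-- other antipodal pair ±e_j in M gives the root p + e_j, whose reflection sends p to
-- −e_j and −p to e_j. If there is no such pair, the segment [p, −p] is an edge of
-- conv(M): a functional vanishing on the i-th axis and equal to −1 on every other
-- point of M (possible precisely because M meets each other axis in at most one
-- point) exposes it. But p − (−p) = 2p lies on a coordinate axis, so it is not
-- parallel to any root, contradicting the Coxeter matroid condition.
module Submission where

open import Data.Nat using (ℕ; zero; suc; s≤s; z≤n)
open import Data.Fin using (Fin; zero; suc; _≟_)
open import Data.Fin.Properties using (suc-injective; any?)
open import Data.Integer using (ℤ; -_; _+_; _-_; _*_; _<_; 0ℤ; 1ℤ; -<+; +<+)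
open import Data.Integer.Properties
  using ( *-identityʳ; *-identityˡ; *-zeroʳ; *-zeroˡ; *-comm; +-identityˡ; +-identityʳ
        ; neg-distribˡ-*; i*j≡0⇒i≡0∨j≡0)
open import Data.Integer.Tactic.RingSolver using (solve-∀)
open import Data.Bool using (true; false; if_then_else_)
open import Data.Bool.Properties using () renaming (_≟_ to _≟ᵇ_)
open import Data.Product using (∃; ∃-syntax; _×_; _,_; proj₁)
open import Data.Sum using (_⊎_; inj₁; inj₂)
open import Data.Empty using (⊥-elim)
open import Function using (_∘_)
open import Relation.Nullary using (¬_; Dec; yes; no)
open import Relation.Nullary.Decidable using (_×-dec_; ¬?)
open import Relation.Binary.PropositionalEquality
open import Defs

open ≡-Reasoning

sumℤ-zero : ∀ {n} (f : Vecℤ n) → (∀ k → f k ≡ 0ℤ) → sumℤ f ≡ 0ℤ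
sumℤ-zero {zero}  f f≡0 = refl
sumℤ-zero {suc n} f f≡0
  rewrite f≡0 zero | sumℤ-zero (f ∘ suc) (f≡0 ∘ suc) = refl

sumℤ-supported : ∀ {n} (f : Vecℤ n) j → (∀ k → k ≢ j → f k ≡ 0ℤ) → sumℤ f ≡ f j
sumℤ-supported {suc n} f zero off
  rewrite sumℤ-zero (f ∘ suc) (λ k → off (suc k) λ ()) = +-identityʳ (f zero)
sumℤ-supported {suc n} f (suc j) off
  rewrite off zero (λ ())
        | sumℤ-supported (f ∘ suc) j (λ k k≢j → off (suc k) (k≢j ∘ suc-injective))
  = +-identityˡ (f (suc j))

e-diag : ∀ {n} (i : Fin n) → e i i ≡ 1ℤ
e-diag i with i ≟ i
... | yes _  = refl
... | no i≢i = ⊥-elim (i≢i refl)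

e-off : ∀ {n} {i k : Fin n} → k ≢ i → e i k ≡ 0ℤ
e-off {i = i} {k} k≢i with i ≟ k
... | yes i≡k = ⊥-elim (k≢i (sym i≡k))
... | no _    = refl

·-vec : ∀ {n} (c : Vecℤ n) u m → c · vec (u , m) ≡ c m * sgn u
·-vec c u m = begin
  c · vec (u , m)       ≡⟨ sumℤ-supported _ m off ⟩
  c m * (sgn u * e m m) ≡⟨ cong (λ x → c m * (sgn u * x)) (e-diag m) ⟩
  c m * (sgn u * 1ℤ)    ≡⟨ cong (c m *_) (*-identityʳ (sgn u)) ⟩
  c m * sgn u           ∎
  where
  off : ∀ k → k ≢ m → c k * (sgn u * e m k) ≡ 0ℤ
  off k k≢m rewrite e-off k≢m | *-zeroʳ (sgn u) = *-zeroʳ (c k)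

flip : Sign → Sign
flip plus  = minus
flip minus = plus

≢⇒flip : ∀ {s t} → s ≢ t → t ≡ flip s
≢⇒flip {plus}  {plus}  s≢t = ⊥-elim (s≢t refl)
≢⇒flip {plus}  {minus} _   = refl
≢⇒flip {minus} {plus}  _   = refl
≢⇒flip {minus} {minus} s≢t = ⊥-elim (s≢t refl)

≡⊎≡flip : ∀ u s → u ≡ s ⊎ u ≡ flip s
≡⊎≡flip plus  plus  = inj₁ refl
≡⊎≡flip plus  minus = inj₂ refl
≡⊎≡flip minus plus  = inj₂ refl
≡⊎≡flip minus minus = inj₁ refl

≢flip : ∀ s → s ≢ flip s
≢flip plus  ()
≢flip minus ()

sgn-flip : ∀ s → sgn (flip s) ≡ - sgn s
sgn-flip plus  = refl
sgn-flip minus = refl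

sgn*sgn : ∀ s → sgn s * sgn s ≡ 1ℤ
sgn*sgn plus  = refl
sgn*sgn minus = refl

sgn-flip*sgn : ∀ s → sgn (flip s) * sgn s ≡ - 1ℤ
sgn-flip*sgn plus  = refl
sgn-flip*sgn minus = refl

sgn≢0 : ∀ s → sgn s ≢ 0ℤ
sgn≢0 plus  ()
sgn≢0 minus ()

sgn-sgn-flip≢0 : ∀ s → sgn s - sgn (flip s) ≢ 0ℤ
sgn-sgn-flip≢0 plus  ()
sgn-sgn-flip≢0 minus ()

vec-flip : ∀ {n} s (i : Fin n) k → vec (flip s , i) k ≡ - vec (s , i) k
vec-flip s i k = trans (cong (_* e i k) (sgn-flip s)) (sym (neg-distribˡ-* (sgn s) (e i k)))

root : ∀ {n} → Sign → Fin n → Sign → Fin n → Vecℤ n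
root s i t j k = vec (s , i) k + vec (t , j) k

root-isRoot : ∀ {n} s {i j : Fin n} t → i ≢ j → IsRoot (root s i t j)
root-isRoot s {i} {j} t i≢j = s , i , t , j , i≢j , λ _ → refl

root-at-fst : ∀ {n} s {i j : Fin n} t → i ≢ j → root s i t j i ≡ sgn s
root-at-fst s {i} t i≢j rewrite e-diag i | e-off i≢j
  | *-identityʳ (sgn s) | *-zeroʳ (sgn t) = +-identityʳ (sgn s)

root-at-snd : ∀ {n} s {i j : Fin n} t → i ≢ j → root s i t j j ≡ sgn t
root-at-snd s {i} {j} t i≢j rewrite e-diag j | e-off (i≢j ∘ sym)
  | *-identityʳ (sgn t) | *-zeroʳ (sgn s) = +-identityˡ (sgn t)

IsRoot-off-axis : ∀ {n} {α : Vecℤ n} → IsRoot α → ∀ i → ∃[ k ] (k ≢ i × ∃[ σ ] α k ≡ sgn σ)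
IsRoot-off-axis (s , i′ , t , j′ , i′≢j′ , α≡) i with i′ ≟ i
... | yes refl = j′ , i′≢j′ ∘ sym , t , trans (α≡ j′) (root-at-snd s t i′≢j′)
... | no i′≢i  = i′ , i′≢i , s , trans (α≡ i′) (root-at-fst s t i′≢j′)

SeparatingRoot : ∀ {n} → Sub n → Pt n → Pt n → Set
SeparatingRoot M p q = ∃[ α ] (IsRoot α × Separates α (vec p) (vec q) ×
                               refl-in α (vec p) ∈ᵥ M × refl-in α (vec q) ∈ᵥ M)

separatingRoot : ∀ {n} {M : Sub n} {p q : Pt n} {α : Vecℤ n} → IsRoot α →
  α · vec p ≡ 1ℤ → α · vec q ≡ - 1ℤ →
  ∀ r → r ∈ M → (∀ k → vec r k ≡ vec p k - α k) →
  ∀ r′ → r′ ∈ M → (∀ k → vec r′ k ≡ vec q k + α k) →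
  SeparatingRoot M p q
separatingRoot {p = p} {q} {α} isRoot αp≡1 αq≡-1 r r∈M r≡ r′ r′∈M r′≡ =
  α , isRoot , inj₁ (subst (0ℤ <_) (sym αp≡1) (+<+ (s≤s z≤n)) , subst (_< 0ℤ) (sym αq≡-1) -<+) ,
  (r , r∈M , reflect-p) , (r′ , r′∈M , reflect-q)
  where
  +≡-neg-one-* : ∀ x y → x + y ≡ x - (- 1ℤ) * y
  +≡-neg-one-* = solve-∀
  reflect-p : ∀ k → vec r k ≡ vec p k - (α · vec p) * α k
  reflect-p k rewrite αp≡1 | *-identityˡ (α k) = r≡ k
  reflect-q : ∀ k → vec r′ k ≡ vec q k - (α · vec q) * α k
  reflect-q k rewrite αq≡-1 = trans (r′≡ k) (+≡-neg-one-* (vec q k) (α k))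

separatingRoot-distinct-axes : ∀ {n} {M : Sub n} {s t} {i j : Fin n} → i ≢ j →
  (s , i) ∈ M → (t , j) ∈ M → SeparatingRoot M (s , i) (t , j)
separatingRoot-distinct-axes {n} {M} {s} {t} {i} {j} i≢j p∈M q∈M =
  separatingRoot {M = M} {s , i} {t , j} (root-isRoot s (flip t) i≢j) αp≡1 αq≡-1
                 (t , j) q∈M reflect-p (s , i) p∈M reflect-q
  where
  α : Vecℤ n
  α = root s i (flip t) j
  αp≡1 : α · vec (s , i) ≡ 1ℤ
  αp≡1 = begin
    α · vec (s , i) ≡⟨ ·-vec α s i ⟩
    α i * sgn s     ≡⟨ cong (_* sgn s) (root-at-fst s (flip t) i≢j) ⟩
    sgn s * sgn s   ≡⟨ sgn*sgn s ⟩
    1ℤ              ∎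
  αq≡-1 : α · vec (t , j) ≡ - 1ℤ
  αq≡-1 = begin
    α · vec (t , j)        ≡⟨ ·-vec α t j ⟩
    α j * sgn t            ≡⟨ cong (_* sgn t) (root-at-snd s (flip t) i≢j) ⟩
    sgn (flip t) * sgn t   ≡⟨ sgn-flip*sgn t ⟩
    - 1ℤ                   ∎
  cancel₁ : ∀ x y → y ≡ x - (x + - y)
  cancel₁ = solve-∀
  cancel₂ : ∀ x y → x ≡ y + (x + - y)
  cancel₂ = solve-∀
  reflect-p : ∀ k → vec (t , j) k ≡ vec (s , i) k - α k
  reflect-p k = trans (cancel₁ (vec (s , i) k) (vec (t , j) k))
                      (cong (λ z → vec (s , i) k - (vec (s , i) k + z)) (sym (vec-flip t j k)))
  reflect-q : ∀ k → vec (s , i) k ≡ vec (t , j) k + α k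
  reflect-q k = trans (cancel₂ (vec (s , i) k) (vec (t , j) k))
                      (cong (λ z → vec (t , j) k + (vec (s , i) k + z)) (sym (vec-flip t j k)))

AntipodalPairOff : ∀ {n} → Sub n → Fin n → Fin n → Set
AntipodalPairOff M i j = j ≢ i × (plus , j) ∈ M × (minus , j) ∈ M

separatingRoot-antipodal : ∀ {n} {M : Sub n} {s} {i j : Fin n} →
  AntipodalPairOff M i j → SeparatingRoot M (s , i) (flip s , i)
separatingRoot-antipodal {n} {M} {s} {i} {j} (j≢i , +j∈M , -j∈M) =
  separatingRoot {M = M} {s , i} {flip s , i} (root-isRoot s plus i≢j) αp≡1 αq≡-1
                 (minus , j) -j∈M reflect-p (plus , j) +j∈M reflect-q
  where
  i≢j : i ≢ j
  i≢j = j≢i ∘ sym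
  α : Vecℤ n
  α = root s i plus j
  αp≡1 : α · vec (s , i) ≡ 1ℤ
  αp≡1 = begin
    α · vec (s , i) ≡⟨ ·-vec α s i ⟩
    α i * sgn s     ≡⟨ cong (_* sgn s) (root-at-fst s plus i≢j) ⟩
    sgn s * sgn s   ≡⟨ sgn*sgn s ⟩
    1ℤ              ∎
  αq≡-1 : α · vec (flip s , i) ≡ - 1ℤ
  αq≡-1 = begin
    α · vec (flip s , i)  ≡⟨ ·-vec α (flip s) i ⟩
    α i * sgn (flip s)    ≡⟨ cong (_* sgn (flip s)) (root-at-fst s plus i≢j) ⟩
    sgn s * sgn (flip s)  ≡⟨ *-comm (sgn s) (sgn (flip s)) ⟩
    sgn (flip s) * sgn s  ≡⟨ sgn-flip*sgn s ⟩
    - 1ℤ                  ∎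
  cancel₁ : ∀ x y → - y ≡ x - (x + y)
  cancel₁ = solve-∀
  cancel₂ : ∀ x y → y ≡ - x + (x + y)
  cancel₂ = solve-∀
  reflect-p : ∀ k → vec (minus , j) k ≡ vec (s , i) k - α k
  reflect-p k = trans (vec-flip plus j k) (cancel₁ (vec (s , i) k) (vec (plus , j) k))
  reflect-q : ∀ k → vec (plus , j) k ≡ vec (flip s , i) k + α k
  reflect-q k = trans (cancel₂ (vec (s , i) k) (vec (plus , j) k)) (cong (_+ α k) (sym (vec-flip s i k)))

exposing : ∀ {n} → Sub n → Fin n → Vecℤ n
exposing M i k with k ≟ i
... | yes _ = 0ℤ
... | no  _ = if M (plus , k) then - 1ℤ else 1ℤ

exposing-on-axis : ∀ {n} (M : Sub n) i u → exposing M i · vec (u , i) ≡ 0ℤ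
exposing-on-axis M i u = trans (·-vec (exposing M i) u i) (cong (_* sgn u) on-axis)
  where
  on-axis : exposing M i i ≡ 0ℤ
  on-axis with i ≟ i
  ... | yes _  = refl
  ... | no i≢i = ⊥-elim (i≢i refl)

exposing-off-axis : ∀ {n} {M : Sub n} {i} → ¬ ∃ (AntipodalPairOff M i) →
  ∀ {u m} → (u , m) ∈ M → m ≢ i → exposing M i · vec (u , m) ≡ - 1ℤ
exposing-off-axis {M = M} {i} none {u} {m} r∈M m≢i =
  trans (·-vec (exposing M i) u m) (off-axis u r∈M)
  where
  off-axis : ∀ u → (u , m) ∈ M → exposing M i m * sgn u ≡ - 1ℤ
  off-axis u r∈M with m ≟ i
  ... | yes m≡i = ⊥-elim (m≢i m≡i)
  off-axis plus  r∈M | no _ rewrite r∈M = refl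
  off-axis minus r∈M | no _ with M (plus , m) in +m∈M
  ... | true  = ⊥-elim (none (m , m≢i , +m∈M , r∈M))
  ... | false = refl

antipodal-edge : ∀ {n} {M : Sub n} {s i} → ¬ ∃ (AntipodalPairOff M i) →
  (s , i) ∈ M → (flip s , i) ∈ M → IsEdge M (s , i) (flip s , i)
antipodal-edge {M = M} {s} {i} none p∈M q∈M =
  p∈M , q∈M , ≢flip s ∘ cong proj₁ , exposing M i ,
  trans (exposing-on-axis M i s) (sym (exposing-on-axis M i (flip s))) ,
  λ { (u , m) r∈M r≢p r≢q →
      subst₂ _<_ (sym (exposing-off-axis none r∈M (off-axis r≢p r≢q)))
                 (sym (exposing-on-axis M i s)) -<+ }
  where
  off-axis : ∀ {u m} → (u , m) ≢ (s , i) → (u , m) ≢ (flip s , i) → m ≢ i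
  off-axis {u} r≢p r≢q refl with ≡⊎≡flip u s
  ... | inj₁ refl = r≢p refl
  ... | inj₂ refl = r≢q refl

antipodalPairOff? : ∀ {n} (M : Sub n) i → Dec (∃ (AntipodalPairOff M i))
antipodalPairOff? M i =
  any? λ j → ¬? (j ≟ i) ×-dec (M (plus , j) ≟ᵇ true) ×-dec (M (minus , j) ≟ᵇ true)

*-sgn≡0⇒≡0 : ∀ a s → a * sgn s ≡ 0ℤ → a ≡ 0ℤ
*-sgn≡0⇒≡0 a s a*s≡0 with i*j≡0⇒i≡0∨j≡0 a a*s≡0
... | inj₁ a≡0 = a≡0
... | inj₂ s≡0 = ⊥-elim (sgn≢0 s s≡0)

-- A root has a nonzero coordinate off the i-th axis, where 2p vanishes.
antipodal-not-parallel-root : ∀ {n} {α : Vecℤ n} s i → IsRoot α →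
  ¬ Parallel (vec (s , i) ⊖ vec (flip s , i)) α
antipodal-not-parallel-root {α = α} s i isRoot (a , b , a≢0 , a·v≡b·α)
  with IsRoot-off-axis isRoot i
... | k , k≢i , σ , αk≡σ = a≢0 a≡0
  where
  b≡0 : b ≡ 0ℤ
  b≡0 = *-sgn≡0⇒≡0 b σ (begin
    b * sgn σ                                    ≡⟨ cong (b *_) αk≡σ ⟨
    b * α k                                      ≡⟨ a·v≡b·α k ⟨
    a * (sgn s * e i k - sgn (flip s) * e i k)   ≡⟨ cong (λ x → a * (sgn s * x - sgn (flip s) * x)) (e-off k≢i) ⟩
    a * (sgn s * 0ℤ - sgn (flip s) * 0ℤ)         ≡⟨ cong₂ (λ x y → a * (x - y)) (*-zeroʳ (sgn s)) (*-zeroʳ (sgn (flip s))) ⟩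
    a * 0ℤ                                       ≡⟨ *-zeroʳ a ⟩
    0ℤ                                           ∎)
  a≡0 : a ≡ 0ℤ
  a≡0 with i*j≡0⇒i≡0∨j≡0 a (begin
    a * (sgn s - sgn (flip s))                   ≡⟨ cong₂ (λ x y → a * (x - y)) (*-identityʳ (sgn s)) (*-identityʳ (sgn (flip s))) ⟨
    a * (sgn s * 1ℤ - sgn (flip s) * 1ℤ)         ≡⟨ cong (λ x → a * (sgn s * x - sgn (flip s) * x)) (e-diag i) ⟨
    a * (sgn s * e i i - sgn (flip s) * e i i)   ≡⟨ a·v≡b·α i ⟩
    b * α i                                      ≡⟨ cong (_* α i) b≡0 ⟩
    0ℤ * α i                                     ≡⟨ *-zeroˡ (α i) ⟩
    0ℤ                                           ∎)
  ... | inj₁ a≡0  = a≡0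
  ... | inj₂ 2s≡0 = ⊥-elim (sgn-sgn-flip≢0 s 2s≡0)

corollary3p11 : (n : ℕ) (M : Sub n) → IsCoxeterMatroid M → IsStrongCoxeterMatroid M
corollary3p11 n M coxeter (s , i) (t , j) p∈M q∈M p≢q with i ≟ j
... | no i≢j = separatingRoot-distinct-axes i≢j p∈M q∈M
... | yes refl with ≢⇒flip (p≢q ∘ cong (_, i))
... | refl with antipodalPairOff? M i
...   | yes (k , pair) = separatingRoot-antipodal {M = M} {s} pair
...   | no none =
  let α , isRoot , parallel = coxeter (s , i) (flip s , i) (antipodal-edge none p∈M q∈M)
  in  ⊥-elim (antipodal-not-parallel-root s i isRoot parallel)
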